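{- Fix an integer $s>1$. Let $\Phi=(\phi_j)_{j=1}^n$ be an $(a,b,c)$-equiangular tight frame for a $d$-dimensional non-isotropic space $V$ over $\mathbb{F}$. If $\Phi$ contains a regular $s$-simplex, then $a^2=s^2b$ (equivalently $\frac{a^2}{b}=s^2$) and $(n-d)s^2=d(n-1)$ in $\mathbb{F}$. If moreover $\operatorname{Char}\mathbb{F}$ does not divide $sd(n-1)$, then $\frac{n-d}{d(n-1)}=\frac{1}{s^2}$ in $\mathbb{F}$.
   Context: $\mathbb{F}$ is a finite field of one of two kinds: (Case U) $\mathbb{F}=\mathbb{F}_{q^2}$ with involution $x^\sigma=x^q$, or (Case O) $\mathbb{F}=\mathbb{F}_q$ with $x^\sigma=x$; in both cases $q$ is odd. A non-isotropic space is a finite-dimensional $\mathbb{F}$-vector space with a non-degenerate Hermitian scalar product $\langle\cdot,\cdot\rangle$ (linear in the second argument, $\langle u,v\rangle=\langle v,u\rangle^\sigma$, non-degenerate); a subspace is non-isotropic if the restricted form is non-degenerate. A sequence $\Phi$ with synthesis operator $x\mapsto\sum_jx_j\phi_j$ and adjoint $\Phi^\dagger v=(\langle\phi_j,v\rangle)_j$ is a $c$-tight frame for a non-isotropic subspace $U$ if it spans $U$ and $\Phi\Phi^\dagger=cI$ on $U$; it is an $(a,b,c)$-equiangular tight frame for $U$ if moreover $\langle\phi_j,\phi_j\rangle=a$ for all $j$ and $\langle\phi_j,\phi_k\rangle\langle\phi_k,\phi_j\rangle=b$ for $j\neq k$. $\Phi$ contains a regular $s$-simplex if there is $\kappa\subseteq[n]$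 with $|\kappa|=s+1$ such that $(\phi_j)_{j\in\kappa}$ is an $(a,b,c')$-equiangular tight frame, for some $c'$, for its span, which is an $s$-dimensional non-isotropic subspace. Integers and fractions are interpreted in $\mathbb{F}$. -}

module Defs where

open import Level using (0ℓ)
open import Data.Nat as ℕ using (ℕ; zero; suc)
open import Data.Fin using (Fin; zero; suc)
open import Data.Product using (Σ; ∃; _×_; _,_)
open import Data.Sum using (_⊎_)
open import Data.Unit using (⊤)
open import Function using (Injective)
open import Function.Bundles using (_↔_)
open import Relation.Binary.PropositionalEquality using (_≡_; _≢_)

-- Fields (no Field bundle in agda-stdlib): standard axioms, with
-- propositional equality.  _⁻¹ is total but only specified on non-zero
-- elements.

record Field : Set₁ where
  infixl 6 _+_ _-_
  infixl 7 _*_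
  infix  8 -_ _⁻¹
  field
    Carrier : Set
    _+_ _*_ : Carrier → Carrier → Carrier
    -_ _⁻¹  : Carrier → Carrier
    0# 1#   : Carrier
    +-assoc  : ∀ x y z → (x + y) + z ≡ x + (y + z)
    +-comm   : ∀ x y → x + y ≡ y + x
    +-identityˡ : ∀ x → 0# + x ≡ x
    -‿inverseˡ  : ∀ x → (- x) + x ≡ 0#
    *-assoc  : ∀ x y z → (x * y) * z ≡ x * (y * z)
    *-comm   : ∀ x y → x * y ≡ y * x
    *-identityˡ : ∀ x → 1# * x ≡ x
    distribˡ : ∀ x y z → x * (y + z) ≡ (x * y) + (x * z)
    0≢1      : 0# ≢ 1#
    ⁻¹-inverseʳ : ∀ x → x ≢ 0# → x * (x ⁻¹) ≡ 1#

  _-_ : Carrier → Carrier → Carrier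
  x - y = x + (- y)

  fromℕ : ℕ → Carrier
  fromℕ zero    = 0#
  fromℕ (suc k) = 1# + fromℕ k

  _^_ : Carrier → ℕ → Carrier
  x ^ zero  = 1#
  x ^ suc k = x * (x ^ k)

  ∑ : ∀ {m} → (Fin m → Carrier) → Carrier
  ∑ {zero}  f = 0#
  ∑ {suc m} f = f zero + ∑ (λ i → f (suc i))

Odd : ℕ → Set
Odd q = ∃ λ k → q ≡ suc (2 ℕ.* k)

HasCard : Set → ℕ → Set
HasCard A m = Fin m ↔ A

module _ (F : Field) where
  open Field F

  CaseU : (Carrier → Carrier) → Set
  CaseU σ = ∃ λ q → Odd q × HasCard Carrier (q ℕ.* q) × (∀ x → σ x ≡ x ^ q)

  CaseO : (Carrier → Carrier) → Set
  CaseO σ = ∃ λ q → Odd q × HasCard Carrier q × (∀ x → σ x ≡ x)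

  Vec : ℕ → Set
  Vec d = Fin d → Carrier

  module _ {d : ℕ} where
    _≋_ : Vec d → Vec d → Set
    u ≋ v = ∀ i → u i ≡ v i

    _⊕_ : Vec d → Vec d → Vec d
    (u ⊕ v) i = u i + v i

    _·_ : Carrier → Vec d → Vec d
    (k · v) i = k * v i

    𝟎 : Vec d
    𝟎 i = 0#

    lin : ∀ {m} → (Fin m → Carrier) → (Fin m → Vec d) → Vec d
    lin x φ i = ∑ (λ j → x j * φ j i)

    InSpan : ∀ {m} → (Fin m → Vec d) → Vec d → Set
    InSpan φ v = ∃ λ (x : Fin _ → Carrier) → v ≋ lin x φ

    LinIndep : ∀ {m} → (Fin m → Vec d) → Set
    LinIndep e = ∀ (x : Fin _ → Carrier) → lin x e ≋ 𝟎 → ∀ i → x i ≡ 0#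

  -- A non-degenerate Hermitian scalar product on F^d
  -- (σ-semilinear in the first argument, linear in the second).
  record IsHermitianForm (σ : Carrier → Carrier) (d : ℕ)
                         (⟪_,_⟫ : Vec d → Vec d → Carrier) : Set where
    field
      cong      : ∀ {u u′ v v′} → u ≋ u′ → v ≋ v′ → ⟪ u , v ⟫ ≡ ⟪ u′ , v′ ⟫
      additiveʳ : ∀ u v w → ⟪ u , v ⊕ w ⟫ ≡ ⟪ u , v ⟫ + ⟪ u , w ⟫
      homogeneousʳ : ∀ u k v → ⟪ u , k · v ⟫ ≡ k * ⟪ u , v ⟫
      hermitian : ∀ u v → ⟪ u , v ⟫ ≡ σ ⟪ v , u ⟫
      nondegenerate : ∀ u → (∀ v → ⟪ u , v ⟫ ≡ 0#) → u ≋ 𝟎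

  module _ {d : ℕ} (⟪_,_⟫ : Vec d → Vec d → Carrier) where

    NonIsotropic : (Vec d → Set) → Set
    NonIsotropic U = ∀ u → U u → (∀ w → U w → ⟪ u , w ⟫ ≡ 0#) → u ≋ 𝟎

    HasDim : (Vec d → Set) → ℕ → Set
    HasDim U s = Σ (Fin s → Vec d) λ e →
      (∀ i → U (e i)) × LinIndep e × (∀ u → U u → InSpan e u)

    frameOp : ∀ {m} → (Fin m → Vec d) → Vec d → Vec d
    frameOp φ v = lin (λ j → ⟪ φ j , v ⟫) φ

    IsTightFrame : ∀ {m} → Carrier → (Fin m → Vec d) → (Vec d → Set) → Set
    IsTightFrame c φ U =
      (∀ v → U v → InSpan φ v) × (∀ j → U (φ j)) ×
      (∀ v → U v → frameOp φ v ≋ (c · v))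

    IsETF : ∀ {m} → Carrier → Carrier → Carrier → (Fin m → Vec d) →
            (Vec d → Set) → Set
    IsETF a b c φ U =
      IsTightFrame c φ U × (∀ j → ⟪ φ j , φ j ⟫ ≡ a) ×
      (∀ j k → j ≢ k → ⟪ φ j , φ k ⟫ * ⟪ φ k , φ j ⟫ ≡ b)

    -- Φ (an (a,b,c)-ETF) contains a regular s-simplex: an (s+1)-subset κ,
    -- given by an injection Fin (s+1) → Fin n, such that (φ_j)_{j∈κ} is an
    -- (a,b,c')-ETF for its span, an s-dimensional non-isotropic subspace.
    ContainsRegularSimplex : ∀ {n} → Carrier → Carrier → (Fin n → Vec d) →
                             ℕ → Set
    ContainsRegularSimplex a b φ s =
      Σ (Fin (suc s) → Fin _) λ κ → Injective _≡_ _≡_ κ ×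
        let ψ = λ j → φ (κ j) ; U = InSpan ψ in
        (∃ λ c′ → IsETF a b c′ ψ U) × HasDim U s × NonIsotropic U

module Submission where

-- For an (a,b,c)-equiangular tight frame of p+1 vectors spanning an r-dimensional space, the trace
-- of the frame operator gives (p+1)a = rc and the diagonal of ΦΦ†Φ = cΦ gives a² + pb = ca, so
-- r(a² + pb) = (p+1)a².  For the simplex (p = r = s) this reads a² = s²b; for Φ (p = n-1, r = d)
-- it reads d(a² + (n-1)b) = na², i.e. (n-d)s²b = d(n-1)b.  It remains to see b ≠ 0: otherwise
-- a² = 0 too, and since x σ(x) vanishes only at 0 over these fields the whole Gram matrix of the
-- simplex vanishes, so its non-isotropic span would be zero, contradicting dim = s ≥ 1.

open import Level using (0ℓ)
open import Data.Nat using (ℕ; zero; suc; _≤_; s≤s)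
open import Data.Fin as Fin using (Fin; zero; suc)
open import Data.Product using (_×_; _,_; proj₁; proj₂)
open import Data.Sum using (_⊎_; inj₁; inj₂)
open import Data.Unit using (⊤; tt)
open import Data.Empty using (⊥-elim)
open import Function using (_∘_)
open import Function.Properties.Inverse using (↔-sym; ↔⇒↣)
open import Relation.Nullary using (¬_; yes; no)
open import Relation.Nullary.Decidable using (via-injection)
open import Relation.Binary.Definitions using (DecidableEquality)
open import Relation.Binary.PropositionalEquality
open import Algebra.Bundles using (CommutativeRing)
open import Defs hiding (_≋_; _⊕_; _·_)

module FieldProperties (F : Field) where
  open Field F
  open ≡-Reasoning

  commutativeRing : CommutativeRing 0ℓ 0ℓ
  commutativeRing = record
    { isCommutativeRing = record
      { isRing = record
        { +-isAbelianGroup = record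
          { isGroup = record
            { isMonoid = record
              { isSemigroup = record
                { isMagma = record { isEquivalence = isEquivalence ; ∙-cong = cong₂ _+_ }
                ; assoc = +-assoc
                }
              ; identity = +-identityˡ , λ x → trans (+-comm x 0#) (+-identityˡ x)
              }
            ; inverse = -‿inverseˡ , λ x → trans (+-comm x (- x)) (-‿inverseˡ x)
            ; ⁻¹-cong = cong (λ x → - x)
            }
          ; comm = +-comm
          }
        ; *-cong = cong₂ _*_
        ; *-assoc = *-assoc
        ; *-identity = *-identityˡ , λ x → trans (*-comm x 1#) (*-identityˡ x)
        ; distrib = distribˡ , λ x y z → trans (*-comm (y + z) x)
                     (trans (distribˡ x y z) (cong₂ _+_ (*-comm x y) (*-comm x z)))
        }
      ; *-comm = *-comm
      }
    }

  open CommutativeRing commutativeRing public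
    using (+-identityʳ; -‿inverseʳ; *-identityʳ; distribʳ; zeroˡ; zeroʳ)
  open import Algebra.Properties.Group (CommutativeRing.+-group commutativeRing)
    using (x∙y⁻¹≈ε⇒x≈y; ∙-cancelˡ; ∙-cancelʳ; //-rightDividesˡ; x≈z//y)
  open import Algebra.Properties.Ring (CommutativeRing.ring commutativeRing)
    using ([y-z]x≈yx-zx)
  open import Algebra.Solver.Ring.NaturalCoefficients.Default
    (CommutativeRing.commutativeSemiring commutativeRing)
    using (solve; _:=_; _:+_; _:*_; con)

  x≢0∧x*y≡0⇒y≡0 : ∀ {x y} → x ≢ 0# → x * y ≡ 0# → y ≡ 0#
  x≢0∧x*y≡0⇒y≡0 {x} {y} x≢0 xy≡0 = begin
    y                ≡⟨ *-identityˡ y ⟨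
    1# * y           ≡⟨ cong (_* y) (⁻¹-inverseʳ x x≢0) ⟨
    x * x ⁻¹ * y     ≡⟨ solve 3 (λ x x′ y → x :* x′ :* y := x′ :* (x :* y)) refl x (x ⁻¹) y ⟩
    x ⁻¹ * (x * y)   ≡⟨ cong (x ⁻¹ *_) xy≡0 ⟩
    x ⁻¹ * 0#        ≡⟨ zeroʳ (x ⁻¹) ⟩
    0#               ∎

  x*y≢0⇒y≢0 : ∀ {x y} → x * y ≢ 0# → y ≢ 0#
  x*y≢0⇒y≢0 {x} xy≢0 y≡0 = xy≢0 (trans (cong (x *_) y≡0) (zeroʳ x))

  ^-≢0 : ∀ {x} k → x ≢ 0# → x ^ k ≢ 0#
  ^-≢0 zero    x≢0 1≡0 = 0≢1 (sym 1≡0)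
  ^-≢0 (suc k) x≢0 = ^-≢0 k x≢0 ∘ x≢0∧x*y≡0⇒y≡0 x≢0

  *-cancelʳ : ∀ {x y z} → z ≢ 0# → x * z ≡ y * z → x ≡ y
  *-cancelʳ {x} {y} {z} z≢0 xz≡yz = begin
    x                ≡⟨ *-identityʳ x ⟨
    x * 1#           ≡⟨ cong (x *_) (⁻¹-inverseʳ z z≢0) ⟨
    x * (z * z ⁻¹)   ≡⟨ *-assoc x z (z ⁻¹) ⟨
    x * z * z ⁻¹     ≡⟨ cong (_* z ⁻¹) xz≡yz ⟩
    y * z * z ⁻¹     ≡⟨ *-assoc y z (z ⁻¹) ⟩
    y * (z * z ⁻¹)   ≡⟨ cong (y *_) (⁻¹-inverseʳ z z≢0) ⟩
    y * 1#           ≡⟨ *-identityʳ y ⟩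
    y                ∎

  x*z≡y⇒x*y⁻¹≡z⁻¹ : ∀ {x y z} → x * z ≡ y → y ≢ 0# → x * y ⁻¹ ≡ z ⁻¹
  x*z≡y⇒x*y⁻¹≡z⁻¹ {x} {y} {z} xz≡y y≢0 = begin
    x * y ⁻¹                ≡⟨ *-identityʳ (x * y ⁻¹) ⟨
    x * y ⁻¹ * 1#           ≡⟨ cong (x * y ⁻¹ *_) (⁻¹-inverseʳ z z≢0) ⟨
    x * y ⁻¹ * (z * z ⁻¹)   ≡⟨ solve 4 (λ x y′ z z′ → x :* y′ :* (z :* z′) := x :* z :* y′ :* z′)
                                     refl x (y ⁻¹) z (z ⁻¹) ⟩
    x * z * y ⁻¹ * z ⁻¹     ≡⟨ cong (λ u → u * y ⁻¹ * z ⁻¹) xz≡y ⟩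
    y * y ⁻¹ * z ⁻¹         ≡⟨ cong (_* z ⁻¹) (⁻¹-inverseʳ y y≢0) ⟩
    1# * z ⁻¹               ≡⟨ *-identityˡ (z ⁻¹) ⟩
    z ⁻¹                    ∎
    where
    z≢0 : z ≢ 0#
    z≢0 z≡0 = y≢0 (trans (sym xz≡y) (trans (cong (x *_) z≡0) (zeroʳ x)))

  x+y-x≡y : ∀ x y → x + y - x ≡ y
  x+y-x≡y x y = sym (x≈z//y y x (x + y) (+-comm y x))

  s[a²+sb]≡[1+s]a²⇒a²≡s²b : ∀ {s a b} → s * (a * a + s * b) ≡ (1# + s) * (a * a) →
                            a * a ≡ s * s * b
  s[a²+sb]≡[1+s]a²⇒a²≡s²b {s} {a} {b} eq =
    sym (∙-cancelˡ (s * (a * a)) (s * s * b) (a * a) (begin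
    s * (a * a) + s * s * b  ≡⟨ solve 3 (λ s A b → s :* A :+ s :* s :* b := s :* (A :+ s :* b))
                                        refl s (a * a) b ⟩
    s * (a * a + s * b)      ≡⟨ eq ⟩
    (1# + s) * (a * a)       ≡⟨ solve 2 (λ s A → (con 1 :+ s) :* A := s :* A :+ A) refl s (a * a) ⟩
    s * (a * a) + a * a      ∎))

  d[a²+nb]≡[1+n]a²⇒[1+n-d]x≡dn : ∀ {d n a b x} → b ≢ 0# → a * a ≡ x * b →
    d * (a * a + n * b) ≡ (1# + n) * (a * a) → (1# + n - d) * x ≡ d * (1# + n - 1#)
  d[a²+nb]≡[1+n]a²⇒[1+n-d]x≡dn {d} {n} {a} {b} {x} b≢0 a²≡xb eq = *-cancelʳ b≢0 (begin
    (1# + n - d) * x * b                ≡⟨ *-assoc (1# + n - d) x b ⟩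
    (1# + n - d) * (x * b)              ≡⟨ cong ((1# + n - d) *_) a²≡xb ⟨
    (1# + n - d) * (a * a)              ≡⟨ [y-z]x≈yx-zx (a * a) (1# + n) d ⟩
    (1# + n) * (a * a) - d * (a * a)    ≡⟨ cong (_- d * (a * a)) eq ⟨
    d * (a * a + n * b) - d * (a * a)   ≡⟨ cong (_- d * (a * a)) (distribˡ d (a * a) (n * b)) ⟩
    d * (a * a) + d * (n * b) - d * (a * a)  ≡⟨ x+y-x≡y (d * (a * a)) (d * (n * b)) ⟩
    d * (n * b)                         ≡⟨ cong (λ m → d * (m * b)) (x+y-x≡y 1# n) ⟨
    d * ((1# + n - 1#) * b)             ≡⟨ *-assoc d (1# + n - 1#) b ⟨
    d * (1# + n - 1#) * b               ∎)

  finite⇒decEq : ∀ {m} → HasCard Carrier m → DecidableEquality Carrier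
  finite⇒decEq card = via-injection (↔⇒↣ (↔-sym card)) Fin._≟_

  caseU⊎O⇒decEq : ∀ {σ} → CaseU F σ ⊎ CaseO F σ → DecidableEquality Carrier
  caseU⊎O⇒decEq (inj₁ (_ , _ , card , _)) = finite⇒decEq card
  caseU⊎O⇒decEq (inj₂ (_ , _ , card , _)) = finite⇒decEq card

  σ-≢0 : ∀ {σ} → CaseU F σ ⊎ CaseO F σ → ∀ {x} → x ≢ 0# → σ x ≢ 0#
  σ-≢0 (inj₁ (q , _ , _ , σ≗^q)) {x} x≢0 = ^-≢0 q x≢0 ∘ trans (sym (σ≗^q x))
  σ-≢0 (inj₂ (_ , _ , _ , σ≗id)) {x} x≢0 = x≢0 ∘ trans (sym (σ≗id x))

  x*σx≡0⇒x≡0 : ∀ {σ} → CaseU F σ ⊎ CaseO F σ → ∀ {x} → x * σ x ≡ 0# → x ≡ 0#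
  x*σx≡0⇒x≡0 case {x} xσx≡0 with caseU⊎O⇒decEq case x 0#
  ... | yes x≡0 = x≡0
  ... | no x≢0  = ⊥-elim (σ-≢0 case x≢0 (x≢0∧x*y≡0⇒y≡0 x≢0 xσx≡0))

  ∑-cong : ∀ {m} {f g : Fin m → Carrier} → (∀ i → f i ≡ g i) → ∑ f ≡ ∑ g
  ∑-cong {zero}  f≗g = refl
  ∑-cong {suc m} f≗g = cong₂ _+_ (f≗g zero) (∑-cong (f≗g ∘ suc))

  ∑-distrib-+ : ∀ {m} (f g : Fin m → Carrier) → ∑ (λ i → f i + g i) ≡ ∑ f + ∑ g
  ∑-distrib-+ {zero}  f g = sym (+-identityˡ 0#)
  ∑-distrib-+ {suc m} f g = trans (cong (f zero + g zero +_) (∑-distrib-+ (f ∘ suc) (g ∘ suc)))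
    (solve 4 (λ a b c d → (a :+ b) :+ (c :+ d) := (a :+ c) :+ (b :+ d)) refl _ _ _ _)

  *-distribˡ-∑ : ∀ {m} x (f : Fin m → Carrier) → x * ∑ f ≡ ∑ (λ i → x * f i)
  *-distribˡ-∑ {zero}  x f = zeroʳ x
  *-distribˡ-∑ {suc m} x f = trans (distribˡ x _ _) (cong (x * f zero +_) (*-distribˡ-∑ x (f ∘ suc)))

  *-distribʳ-∑ : ∀ {m} x (f : Fin m → Carrier) → ∑ f * x ≡ ∑ (λ i → f i * x)
  *-distribʳ-∑ x f = trans (*-comm _ x) (trans (*-distribˡ-∑ x f) (∑-cong (λ i → *-comm x (f i))))

  ∑-const : ∀ m x → ∑ {m} (λ _ → x) ≡ fromℕ m * x
  ∑-const zero    x = sym (zeroˡ x)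
  ∑-const (suc m) x = trans (cong (x +_) (∑-const m x))
    (solve 2 (λ x n → x :+ n :* x := (con 1 :+ n) :* x) refl x (fromℕ m))

  ∑-0 : ∀ {m} → ∑ {m} (λ _ → 0#) ≡ 0#
  ∑-0 {m} = trans (∑-const m 0#) (zeroʳ (fromℕ m))

  ∑-comm : ∀ {m p} (f : Fin m → Fin p → Carrier) →
           ∑ (λ i → ∑ (λ j → f i j)) ≡ ∑ (λ j → ∑ (λ i → f i j))
  ∑-comm {zero} {p} f = sym (∑-0 {p})
  ∑-comm {suc m} f = trans (cong (∑ (f zero) +_) (∑-comm (f ∘ suc)))
                           (sym (∑-distrib-+ (f zero) (λ j → ∑ (λ i → f (suc i) j))))

  δ : ∀ {m} → Fin m → Fin m → Carrier
  δ zero    zero    = 1#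
  δ zero    (suc k) = 0#
  δ (suc i) zero    = 0#
  δ (suc i) (suc k) = δ i k

  δ-diag : ∀ {m} (i : Fin m) → δ i i ≡ 1#
  δ-diag zero    = refl
  δ-diag (suc i) = δ-diag i

  ∑-δ : ∀ {m} (i : Fin m) (f : Fin m → Carrier) → ∑ (λ k → δ i k * f k) ≡ f i
  ∑-δ {suc m} zero f = begin
    1# * f zero + ∑ (λ k → 0# * f (suc k))
      ≡⟨ cong₂ _+_ (*-identityˡ _) (trans (∑-cong (zeroˡ ∘ f ∘ suc)) (∑-0 {m})) ⟩
    f zero + 0#                             ≡⟨ +-identityʳ _ ⟩
    f zero                                  ∎
  ∑-δ (suc i) f = begin
    0# * f zero + ∑ (λ k → δ i k * f (suc k))  ≡⟨ cong (_+ ∑ (λ k → δ i k * f (suc k))) (zeroˡ (f zero)) ⟩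
    0# + ∑ (λ k → δ i k * f (suc k))           ≡⟨ +-identityˡ _ ⟩
    ∑ (λ k → δ i k * f (suc k))                ≡⟨ ∑-δ i (f ∘ suc) ⟩
    f (suc i)                                  ∎

  infix  4 _≋_
  infixl 6 _⊕_
  infixr 7 _·_

  _≋_ : ∀ {d} → Vec F d → Vec F d → Set
  _≋_ = Defs._≋_ F

  _⊕_ : ∀ {d} → Vec F d → Vec F d → Vec F d
  _⊕_ = Defs._⊕_ F

  _·_ : ∀ {d} → Carrier → Vec F d → Vec F d
  _·_ = Defs._·_ F

  module _ {d : ℕ} where

    lin-cong : ∀ {m} {x y : Fin m → Carrier} (e : Fin m → Vec F d) →
               (∀ k → x k ≡ y k) → lin F x e ≋ lin F y e
    lin-cong e x≗y t = ∑-cong (λ k → cong (_* e k t) (x≗y k))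

    lin-+ : ∀ {m} (x y : Fin m → Carrier) (e : Fin m → Vec F d) →
            lin F (λ k → x k + y k) e ≋ lin F x e ⊕ lin F y e
    lin-+ x y e t = trans (∑-cong (λ k → distribʳ (e k t) (x k) (y k)))
                          (∑-distrib-+ (λ k → x k * e k t) (λ k → y k * e k t))

    lin-𝟎 : ∀ {m} (x : Fin m → Carrier) {e : Fin m → Vec F d} → (∀ k → e k ≋ 𝟎 F) → lin F x e ≋ 𝟎 F
    lin-𝟎 {m} x e≋𝟎 t = trans (∑-cong (λ k → trans (cong (x k *_) (e≋𝟎 k t)) (zeroʳ (x k))))
                              (∑-0 {m})

    ·-lin-δ : ∀ {m} c (e : Fin m → Vec F d) i → c · e i ≋ lin F (λ k → c * δ i k) e
    ·-lin-δ c e i t = begin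
      c * e i t                          ≡⟨ cong (c *_) (∑-δ i (λ k → e k t)) ⟨
      c * ∑ (λ k → δ i k * e k t)        ≡⟨ *-distribˡ-∑ c (λ k → δ i k * e k t) ⟩
      ∑ (λ k → c * (δ i k * e k t))      ≡⟨ ∑-cong (λ k → *-assoc c (δ i k) (e k t)) ⟨
      ∑ (λ k → c * δ i k * e k t)        ∎

    lin-lin : ∀ {m r} (y : Fin m → Carrier) {φ : Fin m → Vec F d} (x : Fin m → Fin r → Carrier)
              (e : Fin r → Vec F d) → (∀ j → φ j ≋ lin F (x j) e) →
              lin F y φ ≋ lin F (λ k → ∑ (λ j → y j * x j k)) e
    lin-lin y {φ} x e φ≋ t = begin
      ∑ (λ j → y j * φ j t)
        ≡⟨ ∑-cong (λ j → cong (y j *_) (φ≋ j t)) ⟩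
      ∑ (λ j → y j * ∑ (λ k → x j k * e k t))
        ≡⟨ ∑-cong (λ j → *-distribˡ-∑ (y j) (λ k → x j k * e k t)) ⟩
      ∑ (λ j → ∑ (λ k → y j * (x j k * e k t)))
        ≡⟨ ∑-comm (λ j k → y j * (x j k * e k t)) ⟩
      ∑ (λ k → ∑ (λ j → y j * (x j k * e k t)))
        ≡⟨ ∑-cong (λ k → ∑-cong (λ j → *-assoc (y j) (x j k) (e k t))) ⟨
      ∑ (λ k → ∑ (λ j → y j * x j k * e k t))
        ≡⟨ ∑-cong (λ k → *-distribʳ-∑ (e k t) (λ j → y j * x j k)) ⟨
      ∑ (λ k → ∑ (λ j → y j * x j k) * e k t)
        ∎

    LinIndep⇒lin-injective : ∀ {m} {e : Fin m → Vec F d} → LinIndep F e →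
                             ∀ {x y} → lin F x e ≋ lin F y e → ∀ k → x k ≡ y k
    LinIndep⇒lin-injective {e = e} indep {x} {y} x≋y k =
      x∙y⁻¹≈ε⇒x≈y (x k) (y k) (indep (λ k → x k - y k) x-y≋𝟎 k)
      where
      x-y≋𝟎 : lin F (λ k → x k - y k) e ≋ 𝟎 F
      x-y≋𝟎 t = ∙-cancelʳ (lin F y e t) _ _ (begin
        lin F (λ k → x k - y k) e t + lin F y e t   ≡⟨ lin-+ _ y e t ⟨
        lin F (λ k → x k - y k + y k) e t
          ≡⟨ lin-cong e (λ k → //-rightDividesˡ (y k) (x k)) t ⟩
        lin F x e t                                 ≡⟨ x≋y t ⟩
        lin F y e t                                 ≡⟨ +-identityˡ _ ⟨
        0# + lin F y e t                            ∎)

  standardBasis : ∀ {d} → Fin d → Vec F d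
  standardBasis k t = δ t k

  lin-standardBasis : ∀ {d} (x : Vec F d) → lin F x standardBasis ≋ x
  lin-standardBasis x t = trans (∑-cong (λ k → *-comm (x k) (δ t k))) (∑-δ t x)

module HermitianFormProperties
  (F : Field) {σ : Field.Carrier F → Field.Carrier F} {d : ℕ}
  {⟪_,_⟫ : Vec F d → Vec F d → Field.Carrier F} (H : IsHermitianForm F σ d ⟪_,_⟫) where
  open Field F
  open FieldProperties F
  open IsHermitianForm H renaming (cong to ⟪⟫-cong)
  open ≡-Reasoning

  ⟪⟫-congʳ : ∀ u {v v′} → v ≋ v′ → ⟪ u , v ⟫ ≡ ⟪ u , v′ ⟫
  ⟪⟫-congʳ u = ⟪⟫-cong {u} {u} (λ _ → refl)

  ⟪⟫-linʳ : ∀ {m} u (x : Fin m → Carrier) (φ : Fin m → Vec F d) →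
            ⟪ u , lin F x φ ⟫ ≡ ∑ (λ j → x j * ⟪ u , φ j ⟫)
  ⟪⟫-linʳ {zero} u x φ = begin
    ⟪ u , lin F x φ ⟫   ≡⟨ ⟪⟫-congʳ u (λ _ → sym (zeroˡ 0#)) ⟩
    ⟪ u , 0# · 𝟎 F ⟫    ≡⟨ homogeneousʳ u 0# (𝟎 F) ⟩
    0# * ⟪ u , 𝟎 F ⟫    ≡⟨ zeroˡ _ ⟩
    0#                  ∎
  ⟪⟫-linʳ {suc m} u x φ = begin
    ⟪ u , lin F x φ ⟫
      ≡⟨ additiveʳ u (x zero · φ zero) (lin F (x ∘ suc) (φ ∘ suc)) ⟩
    ⟪ u , x zero · φ zero ⟫ + ⟪ u , lin F (x ∘ suc) (φ ∘ suc) ⟫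
      ≡⟨ cong₂ _+_ (homogeneousʳ u (x zero) (φ zero)) (⟪⟫-linʳ u (x ∘ suc) (φ ∘ suc)) ⟩
    x zero * ⟪ u , φ zero ⟫ + ∑ (λ j → x (suc j) * ⟪ u , φ (suc j) ⟫)
      ∎

  wholeSpace-hasDim : HasDim F ⟪_,_⟫ (λ _ → ⊤) d
  wholeSpace-hasDim = standardBasis , (λ _ → tt) , independent , λ v _ → v , sym ∘ lin-standardBasis v
    where
    independent : LinIndep F standardBasis
    independent x x≋𝟎 i = trans (sym (lin-standardBasis x i)) (x≋𝟎 i)

  tightFrame-∑norm≡dim*c : ∀ {m r c U} {φ : Fin m → Vec F d} →
                           IsTightFrame F ⟪_,_⟫ c φ U → HasDim F ⟪_,_⟫ U r →
                           ∑ (λ j → ⟪ φ j , φ j ⟫) ≡ fromℕ r * c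
  tightFrame-∑norm≡dim*c {m} {r} {c} {φ = φ} (_ , φ∈U , tight) (e , e∈U , independent , spans) = begin
    ∑ (λ j → ⟪ φ j , φ j ⟫)
      ≡⟨ ∑-cong (λ j → trans (⟪⟫-congʳ (φ j) (φ≋ j)) (⟪⟫-linʳ (φ j) (x j) e)) ⟩
    ∑ (λ j → ∑ (λ i → x j i * ⟪ φ j , e i ⟫))
      ≡⟨ ∑-comm (λ j i → x j i * ⟪ φ j , e i ⟫) ⟩
    ∑ (λ i → ∑ (λ j → x j i * ⟪ φ j , e i ⟫))
      ≡⟨ ∑-cong (λ i → trans (∑-cong (λ j → *-comm (x j i) _)) (diagonal-coordinate i)) ⟩
    ∑ {r} (λ _ → c)
      ≡⟨ ∑-const r c ⟩
    fromℕ r * c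
      ∎
    where
    x : Fin m → Fin r → Carrier
    x j = proj₁ (spans (φ j) (φ∈U j))

    φ≋ : ∀ j → φ j ≋ lin F (x j) e
    φ≋ j = proj₂ (spans (φ j) (φ∈U j))

    diagonal-coordinate : ∀ i → ∑ (λ j → ⟪ φ j , e i ⟫ * x j i) ≡ c
    diagonal-coordinate i = begin
      ∑ (λ j → ⟪ φ j , e i ⟫ * x j i)  ≡⟨ LinIndep⇒lin-injective independent ΦΦ†eᵢ≋ceᵢ i ⟩
      c * δ i i                       ≡⟨ cong (c *_) (δ-diag i) ⟩
      c * 1#                          ≡⟨ *-identityʳ c ⟩
      c                               ∎
      where
      ΦΦ†eᵢ≋ceᵢ : lin F (λ k → ∑ (λ j → ⟪ φ j , e i ⟫ * x j k)) e ≋ lin F (λ k → c * δ i k) e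
      ΦΦ†eᵢ≋ceᵢ t = trans (sym (lin-lin (λ j → ⟪ φ j , e i ⟫) x e φ≋ t))
                          (trans (tight (e i) (e∈U i) t) (·-lin-δ c e i t))

  etf-a²+pb≡ca : ∀ {p a b c U} {φ : Fin (suc p) → Vec F d} →
                 IsETF F ⟪_,_⟫ a b c φ U → a * a + fromℕ p * b ≡ c * a
  etf-a²+pb≡ca {p} {a} {b} {c} {φ = φ} ((_ , φ∈U , tight) , norm , angle) = begin
    a * a + fromℕ p * b
      ≡⟨ cong₂ _+_ (cong₂ _*_ (norm zero) (norm zero)) (∑-const p b) ⟨
    ⟪ φ zero , φ zero ⟫ * ⟪ φ zero , φ zero ⟫ + ∑ {p} (λ _ → b)
      ≡⟨ cong (⟪ φ zero , φ zero ⟫ * ⟪ φ zero , φ zero ⟫ +_)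
              (∑-cong (λ l → angle (suc l) zero (λ ()))) ⟨
    ∑ (λ l → ⟪ φ l , φ zero ⟫ * ⟪ φ zero , φ l ⟫)
      ≡⟨ ⟪⟫-linʳ (φ zero) (λ l → ⟪ φ l , φ zero ⟫) φ ⟨
    ⟪ φ zero , frameOp F ⟪_,_⟫ φ (φ zero) ⟫
      ≡⟨ ⟪⟫-congʳ (φ zero) (tight (φ zero) (φ∈U zero)) ⟩
    ⟪ φ zero , c · φ zero ⟫
      ≡⟨ homogeneousʳ (φ zero) c (φ zero) ⟩
    c * ⟪ φ zero , φ zero ⟫
      ≡⟨ cong (c *_) (norm zero) ⟩
    c * a
      ∎

  etf-dim[a²+pb]≡[1+p]a² : ∀ {p r a b c U} {φ : Fin (suc p) → Vec F d} →
                           IsETF F ⟪_,_⟫ a b c φ U → HasDim F ⟪_,_⟫ U r →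
                           fromℕ r * (a * a + fromℕ p * b) ≡ fromℕ (suc p) * (a * a)
  etf-dim[a²+pb]≡[1+p]a² {p} {r} {a} {b} {c} {φ = φ} etf@(tight , norm , _) dim = begin
    fromℕ r * (a * a + fromℕ p * b)  ≡⟨ cong (fromℕ r *_) (etf-a²+pb≡ca etf) ⟩
    fromℕ r * (c * a)                ≡⟨ *-assoc (fromℕ r) c a ⟨
    fromℕ r * c * a                  ≡⟨ cong (_* a) ∑norm≡[1+p]a ⟨
    fromℕ (suc p) * a * a            ≡⟨ *-assoc (fromℕ (suc p)) a a ⟩
    fromℕ (suc p) * (a * a)          ∎
    where
    ∑norm≡[1+p]a : fromℕ (suc p) * a ≡ fromℕ r * c
    ∑norm≡[1+p]a = begin
      fromℕ (suc p) * a           ≡⟨ ∑-const (suc p) a ⟨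
      ∑ {suc p} (λ _ → a)         ≡⟨ ∑-cong (sym ∘ norm) ⟩
      ∑ (λ j → ⟪ φ j , φ j ⟫)     ≡⟨ tightFrame-∑norm≡dim*c tight dim ⟩
      fromℕ r * c                 ∎

  etf-gram≡0 : ∀ {m a b c U} {φ : Fin m → Vec F d} → CaseU F σ ⊎ CaseO F σ →
               IsETF F ⟪_,_⟫ a b c φ U → a * a ≡ 0# → b ≡ 0# → ∀ j k → ⟪ φ j , φ k ⟫ ≡ 0#
  etf-gram≡0 {φ = φ} case (_ , norm , angle) a²≡0 b≡0 j k =
    x*σx≡0⇒x≡0 case (trans (cong (⟪ φ j , φ k ⟫ *_) (sym (hermitian (φ k) (φ j)))) (⟪⟫*⟪⟫≡0 j k))
    where
    ⟪⟫*⟪⟫≡0 : ∀ j k → ⟪ φ j , φ k ⟫ * ⟪ φ k , φ j ⟫ ≡ 0#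
    ⟪⟫*⟪⟫≡0 j k with j Fin.≟ k
    ... | yes refl = trans (cong₂ _*_ (norm j) (norm j)) a²≡0
    ... | no j≢k   = trans (angle j k j≢k) b≡0

  gram≡0∧nonIsotropic⇒≋𝟎 : ∀ {m} {φ : Fin m → Vec F d} → NonIsotropic F ⟪_,_⟫ (InSpan F φ) →
                            (∀ j k → ⟪ φ j , φ k ⟫ ≡ 0#) → ∀ j → φ j ≋ 𝟎 F
  gram≡0∧nonIsotropic⇒≋𝟎 {m} {φ} nonIsotropic gram≡0 j =
    nonIsotropic (φ j) (δ j , λ t → sym (∑-δ j (λ k → φ k t))) ⟪φⱼ,-⟫≡0
    where
    ⟪φⱼ,-⟫≡0 : ∀ w → InSpan F φ w → ⟪ φ j , w ⟫ ≡ 0#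
    ⟪φⱼ,-⟫≡0 w (y , w≋) = begin
      ⟪ φ j , w ⟫                        ≡⟨ ⟪⟫-congʳ (φ j) w≋ ⟩
      ⟪ φ j , lin F y φ ⟫                ≡⟨ ⟪⟫-linʳ (φ j) y φ ⟩
      ∑ (λ k → y k * ⟪ φ j , φ k ⟫)
        ≡⟨ ∑-cong (λ k → trans (cong (y k *_) (gram≡0 j k)) (zeroʳ (y k))) ⟩
      ∑ {m} (λ _ → 0#)                   ≡⟨ ∑-0 {m} ⟩
      0#                                 ∎

  ≋𝟎⇒¬span-hasDim-suc : ∀ {m r} {φ : Fin m → Vec F d} → (∀ j → φ j ≋ 𝟎 F) →
                        ¬ HasDim F ⟪_,_⟫ (InSpan F φ) (suc r)
  ≋𝟎⇒¬span-hasDim-suc φ≋𝟎 (e , e∈span , independent , _) =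
    0≢1 (sym (independent (λ _ → 1#) (lin-𝟎 (λ _ → 1#) e≋𝟎) zero))
    where
    e≋𝟎 : ∀ i → e i ≋ 𝟎 F
    e≋𝟎 i t = trans (proj₂ (e∈span i) t) (lin-𝟎 (proj₁ (e∈span i)) φ≋𝟎 t)

  etf-a²≡0⇒b≢0 : ∀ {m r a b c} {φ : Fin m → Vec F d} → CaseU F σ ⊎ CaseO F σ →
                 IsETF F ⟪_,_⟫ a b c φ (InSpan F φ) → HasDim F ⟪_,_⟫ (InSpan F φ) (suc r) →
                 NonIsotropic F ⟪_,_⟫ (InSpan F φ) → a * a ≡ 0# → b ≢ 0#
  etf-a²≡0⇒b≢0 case etf dim nonIsotropic a²≡0 b≡0 =
    ≋𝟎⇒¬span-hasDim-suc (gram≡0∧nonIsotropic⇒≋𝟎 nonIsotropic (etf-gram≡0 case etf a²≡0 b≡0)) dim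

proposition6p5 : (s : ℕ) → 2 ≤ s →
    (F : Field) → (σ : Field.Carrier F → Field.Carrier F) →
    CaseU F σ ⊎ CaseO F σ →
    (d : ℕ) (⟪_,_⟫ : Vec F d → Vec F d → Field.Carrier F) →
    IsHermitianForm F σ d ⟪_,_⟫ →
    (n : ℕ) (φ : Fin n → Vec F d) (a b c : Field.Carrier F) →
    IsETF F ⟪_,_⟫ a b c φ (λ _ → ⊤) →
    ContainsRegularSimplex F ⟪_,_⟫ a b φ s →
    let open Field F in
    (a * a ≡ (fromℕ s * fromℕ s) * b)
    × ((fromℕ n - fromℕ d) * (fromℕ s * fromℕ s) ≡ fromℕ d * (fromℕ n - 1#))
    × (fromℕ s * fromℕ d * (fromℕ n - 1#) ≢ 0# →
       (fromℕ n - fromℕ d) * (fromℕ d * (fromℕ n - 1#)) ⁻¹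
         ≡ (fromℕ s * fromℕ s) ⁻¹)
proposition6p5 s _ F σ case d ⟪_,_⟫ H zero φ a b c _ (κ , _) with κ zero
... | ()
-- The hypothesis 2 ≤ s is only needed as s ≥ 1, which makes the span of the simplex nonzero.
proposition6p5 (suc s) (s≤s _) F σ case d ⟪_,_⟫ H (suc n) φ a b c Φ
               (κ , _ , (_ , Ψ) , dimΨ , nonIsotropicΨ) =
  a²≡s²b , [n-d]s²≡d[n-1] , λ sd[n-1]≢0 →
    x*z≡y⇒x*y⁻¹≡z⁻¹ [n-d]s²≡d[n-1] (x*y≢0⇒y≢0 (sd[n-1]≢0 ∘ trans (*-assoc S D (N - 1#))))
  where
  open Field F
  open FieldProperties F
  open HermitianFormProperties F H

  S D N : Carrier
  S = fromℕ (suc s)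
  D = fromℕ d
  N = fromℕ (suc n)

  a²≡s²b : a * a ≡ S * S * b
  a²≡s²b = s[a²+sb]≡[1+s]a²⇒a²≡s²b (etf-dim[a²+pb]≡[1+p]a² Ψ dimΨ)

  b≢0 : b ≢ 0#
  b≢0 b≡0 = etf-a²≡0⇒b≢0 case Ψ dimΨ nonIsotropicΨ
    (trans a²≡s²b (trans (cong (S * S *_) b≡0) (zeroʳ (S * S)))) b≡0

  [n-d]s²≡d[n-1] : (N - D) * (S * S) ≡ D * (N - 1#)
  [n-d]s²≡d[n-1] =
    d[a²+nb]≡[1+n]a²⇒[1+n-d]x≡dn b≢0 a²≡s²b (etf-dim[a²+pb]≡[1+p]a² Φ wholeSpace-hasDim)
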